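{- For any term $r$, the set $\{s \mid s\rightleftarrows^* r\}$ is finite (modulo $\alpha$-equivalence).
   Context: Preterms are $r ::= x \mid \lambda x.r \mid rr \mid r\times r \mid \pi_A(r)$ (application left associative), where $A$ ranges over types generated by $A::=\tau\mid A\Rightarrow A\mid A\wedge A$ and variables are drawn from sets $\mathcal V_A$ indexed by types; one writes $\lambda x^A.r$ for $\lambda x.r$ when $x\in\mathcal V_A$. Terms are the well-typed preterms. The relation $\rightleftarrows$ is the smallest symmetric relation on terms, closed under all term contexts, containing: $r\times s\rightleftarrows s\times r$; $(r\times s)\times t\rightleftarrows r\times(s\times t)$; $\lambda x^A.(r\times s)\rightleftarrows \lambda x^A.r\times\lambda x^A.s$; $rst\rightleftarrows r(s\times t)$. $\rightleftarrows^*$ is its reflexive transitive closure. -}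

module Defs where

open import Data.Nat using (ℕ; zero; suc)
open import Data.List using (List; []; _∷_)
open import Data.Product using (Σ; ∃; _×_)
open import Data.List.Membership.Propositional using (_∈_)
open import Relation.Binary.Construct.Closure.ReflexiveTransitive using (Star)

infixr 7 _⇒_
infixr 8 _∧_

data Ty : Set where
  τ   : Ty
  _⇒_ : Ty → Ty → Ty
  _∧_ : Ty → Ty → Ty

data _≅_ : Ty → Ty → Set where
  ≅-refl  : ∀ {A} → A ≅ A
  ≅-sym   : ∀ {A B} → A ≅ B → B ≅ A
  ≅-trans : ∀ {A B C} → A ≅ B → B ≅ C → A ≅ C
  ≅-⇒     : ∀ {A A′ B B′} → A ≅ A′ → B ≅ B′ → (A ⇒ B) ≅ (A′ ⇒ B′)
  ≅-∧     : ∀ {A A′ B B′} → A ≅ A′ → B ≅ B′ → (A ∧ B) ≅ (A′ ∧ B′)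
  ≅-comm  : ∀ {A B} → (A ∧ B) ≅ (B ∧ A)
  ≅-assoc : ∀ {A B C} → ((A ∧ B) ∧ C) ≅ (A ∧ (B ∧ C))
  ≅-dist  : ∀ {A B C} → (A ⇒ (B ∧ C)) ≅ ((A ⇒ B) ∧ (A ⇒ C))
  ≅-curry : ∀ {A B C} → ((A ∧ B) ⇒ C) ≅ (A ⇒ (B ⇒ C))

-- Preterms modulo α-equivalence: bound variables are de Bruijn indices,
-- free variables are named, x ∈ 𝒱_A is  fvar A n  (the n-th variable of 𝒱_A).
-- lam A r  is  λx^A.r ;  proj A r  is  π_A(r).
data PT : Set where
  fvar : Ty → ℕ → PT
  bvar : ℕ → PT
  lam  : Ty → PT → PT
  app  : PT → PT → PT
  pair : PT → PT → PT
  proj : Ty → PT → PT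

data _∋_∶_ : List Ty → ℕ → Ty → Set where
  here  : ∀ {Γ A} → (A ∷ Γ) ∋ zero ∶ A
  there : ∀ {Γ A B n} → Γ ∋ n ∶ A → (B ∷ Γ) ∋ suc n ∶ A

data _⊢_∶_ (Γ : List Ty) : PT → Ty → Set where
  ax-f : ∀ {A n} → Γ ⊢ fvar A n ∶ A
  ax-b : ∀ {A n} → Γ ∋ n ∶ A → Γ ⊢ bvar n ∶ A
  conv : ∀ {r A B} → Γ ⊢ r ∶ A → A ≅ B → Γ ⊢ r ∶ B
  ⇒i   : ∀ {r A B} → (A ∷ Γ) ⊢ r ∶ B → Γ ⊢ lam A r ∶ (A ⇒ B)
  ⇒e   : ∀ {r s A B} → Γ ⊢ r ∶ (A ⇒ B) → Γ ⊢ s ∶ A → Γ ⊢ app r s ∶ B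
  ∧i   : ∀ {r s A B} → Γ ⊢ r ∶ A → Γ ⊢ s ∶ B → Γ ⊢ pair r s ∶ (A ∧ B)
  ∧e   : ∀ {r A B} → Γ ⊢ r ∶ (A ∧ B) → Γ ⊢ proj A r ∶ A

IsTerm : PT → Set
IsTerm r = ∃ λ A → [] ⊢ r ∶ A

data _↝_ : PT → PT → Set where
  comm   : ∀ {r s} → pair r s ↝ pair s r
  assoc  : ∀ {r s t} → pair (pair r s) t ↝ pair r (pair s t)
  dist   : ∀ {A r s} → lam A (pair r s) ↝ pair (lam A r) (lam A s)
  curry  : ∀ {r s t} → app (app r s) t ↝ app r (pair s t)
  sym↝   : ∀ {r s} → r ↝ s → s ↝ r
  c-lam  : ∀ {A r r′} → r ↝ r′ → lam A r ↝ lam A r′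
  c-appˡ : ∀ {r r′ s} → r ↝ r′ → app r s ↝ app r′ s
  c-appʳ : ∀ {r s s′} → s ↝ s′ → app r s ↝ app r s′
  c-pairˡ : ∀ {r r′ s} → r ↝ r′ → pair r s ↝ pair r′ s
  c-pairʳ : ∀ {r s s′} → s ↝ s′ → pair r s ↝ pair r s′
  c-proj : ∀ {A r r′} → r ↝ r′ → proj A r ↝ proj A r′

_⇄_ : PT → PT → Set
r ⇄ s = (r ↝ s) × IsTerm r × IsTerm s

_⇄*_ : PT → PT → Set
_⇄*_ = Star _⇄_

FiniteSet : (PT → Set) → Set
FiniteSet P = Σ (List PT) λ L → ∀ s → P s → s ∈ L

module Submission where

-- Two quantities of a preterm are invariant under a single rewriting step
-- r ↝ s, hence under ⇄*:
--   * its weight, a size measure in which a λ counts its body twice, so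
--     that distributing λx.(r×s) into λx.r × λx.s does not change it;
--   * the fact of being built from a given finite supply of leaves
--     (variables) and type annotations (of λ and π): the rules only
--     rearrange, duplicate or merge existing leaves and annotations.
-- Independently, the preterms built from finite supplies with bounded
-- weight form a finite set, enumerated layer by layer (terms La Lt d).
-- Every s ⇄* r is built from the leaves and annotations of r and has the
-- weight of r, so it lies in that finite enumeration.

open import Defs
open import Data.Nat using (ℕ; zero; suc; _+_; _≤_; s≤s; z≤n)
open import Data.Nat.Properties
  using (≤-trans; ≤-pred; ≤-reflexive; m≤m+n; m≤n+m; m<m+n; m<n+m; +-comm; +-assoc)
open import Data.List using (List; []; _∷_; _++_; cartesianProductWith)
open import Data.List.Relation.Unary.Any using (here; there)
open import Data.List.Membership.Propositional using (_∈_)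
open import Data.List.Membership.Propositional.Properties
  using (∈-++⁺ˡ; ∈-++⁺ʳ; ∈-cartesianProductWith⁺)
open import Data.Product using (Σ; _×_; _,_; proj₁; swap; assocʳ′; assocˡ′)
open import Data.Product.Function.NonDependent.Propositional using (_×-⇔_)
open import Function using (id)
open import Function.Bundles using (_⇔_; mk⇔; Equivalence)
import Function.Properties.Equivalence as ⇔
open import Relation.Binary.Construct.Closure.ReflexiveTransitive using (fold)
open import Relation.Binary.PropositionalEquality
  using (_≡_; refl; sym; trans; cong; cong₂; module ≡-Reasoning)

weight : PT → ℕ
weight (fvar _ _)  = 1
weight (bvar _)    = 1
weight (lam _ r)   = weight r + weight r
weight (app r s)   = weight r + weight s
weight (pair r s)  = weight r + weight s
weight (proj _ r)  = weight r + 1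

weight-positive : ∀ s → 1 ≤ weight s
weight-positive (fvar _ _) = s≤s z≤n
weight-positive (bvar _)   = s≤s z≤n
weight-positive (lam _ r)  = ≤-trans (weight-positive r) (m≤m+n (weight r) (weight r))
weight-positive (app r s)  = ≤-trans (weight-positive r) (m≤m+n (weight r) (weight s))
weight-positive (pair r s) = ≤-trans (weight-positive r) (m≤m+n (weight r) (weight s))
weight-positive (proj _ r) = m≤n+m 1 (weight r)

-- The arithmetic behind the distributivity rule: 2(a + b) = 2a + 2b.
+-interchange : ∀ a b c d → (a + b) + (c + d) ≡ (a + c) + (b + d)
+-interchange a b c d = begin
  (a + b) + (c + d)  ≡⟨ +-assoc a b (c + d) ⟩
  a + (b + (c + d))  ≡⟨ cong (a +_) (sym (+-assoc b c d)) ⟩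
  a + ((b + c) + d)  ≡⟨ cong (λ x → a + (x + d)) (+-comm b c) ⟩
  a + ((c + b) + d)  ≡⟨ cong (a +_) (+-assoc c b d) ⟩
  a + (c + (b + d))  ≡⟨ sym (+-assoc a c (b + d)) ⟩
  (a + c) + (b + d)  ∎
  where open ≡-Reasoning

weight-↝ : ∀ {r s} → r ↝ s → weight r ≡ weight s
weight-↝ (comm {r} {s})      = +-comm (weight r) (weight s)
weight-↝ (assoc {r} {s} {t}) = +-assoc (weight r) (weight s) (weight t)
weight-↝ (dist {_} {r} {s})  = +-interchange (weight r) (weight s) (weight r) (weight s)
weight-↝ (curry {r} {s} {t}) = +-assoc (weight r) (weight s) (weight t)
weight-↝ (sym↝ p)    = sym (weight-↝ p)
weight-↝ (c-lam p)   = cong₂ _+_ (weight-↝ p) (weight-↝ p)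
weight-↝ (c-appˡ p)  = cong (_+ _) (weight-↝ p)
weight-↝ (c-appʳ p)  = cong (_ +_) (weight-↝ p)
weight-↝ (c-pairˡ p) = cong (_+ _) (weight-↝ p)
weight-↝ (c-pairʳ p) = cong (_ +_) (weight-↝ p)
weight-↝ (c-proj p)  = cong (_+ 1) (weight-↝ p)

BuiltFrom : (PT → Set) → (Ty → Set) → PT → Set
BuiltFrom P Q (fvar A n) = P (fvar A n)
BuiltFrom P Q (bvar n)   = P (bvar n)
BuiltFrom P Q (lam A r)  = Q A × BuiltFrom P Q r
BuiltFrom P Q (app r s)  = BuiltFrom P Q r × BuiltFrom P Q s
BuiltFrom P Q (pair r s) = BuiltFrom P Q r × BuiltFrom P Q s
BuiltFrom P Q (proj A r) = Q A × BuiltFrom P Q r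

BuiltFrom-mono : ∀ {P Q P′ Q′} → (∀ x → P x → P′ x) → (∀ A → Q A → Q′ A) →
                 ∀ s → BuiltFrom P Q s → BuiltFrom P′ Q′ s
BuiltFrom-mono f g (fvar A n) b       = f _ b
BuiltFrom-mono f g (bvar n) b         = f _ b
BuiltFrom-mono f g (lam A r) (q , b)  = g A q , BuiltFrom-mono f g r b
BuiltFrom-mono f g (app r s) (b , c)  = BuiltFrom-mono f g r b , BuiltFrom-mono f g s c
BuiltFrom-mono f g (pair r s) (b , c) = BuiltFrom-mono f g r b , BuiltFrom-mono f g s c
BuiltFrom-mono f g (proj A r) (q , b) = g A q , BuiltFrom-mono f g r b

BuiltFrom-↝ : ∀ {P Q r s} → r ↝ s → BuiltFrom P Q r ⇔ BuiltFrom P Q s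
BuiltFrom-↝ comm  = mk⇔ swap swap
BuiltFrom-↝ assoc = mk⇔ assocʳ′ assocˡ′
BuiltFrom-↝ dist  = mk⇔ (λ (q , b , c) → (q , b) , (q , c)) (λ ((q , b) , (_ , c)) → q , b , c)
BuiltFrom-↝ curry = mk⇔ assocʳ′ assocˡ′
BuiltFrom-↝ (sym↝ p)    = ⇔.sym (BuiltFrom-↝ p)
BuiltFrom-↝ (c-lam p)   = ⇔.refl ×-⇔ BuiltFrom-↝ p
BuiltFrom-↝ (c-appˡ p)  = BuiltFrom-↝ p ×-⇔ ⇔.refl
BuiltFrom-↝ (c-appʳ p)  = ⇔.refl ×-⇔ BuiltFrom-↝ p
BuiltFrom-↝ (c-pairˡ p) = BuiltFrom-↝ p ×-⇔ ⇔.refl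
BuiltFrom-↝ (c-pairʳ p) = ⇔.refl ×-⇔ BuiltFrom-↝ p
BuiltFrom-↝ (c-proj p)  = ⇔.refl ×-⇔ BuiltFrom-↝ p

weight-⇄* : ∀ {s r} → s ⇄* r → weight s ≡ weight r
weight-⇄* = fold (λ s r → weight s ≡ weight r) (λ step → trans (weight-↝ (proj₁ step))) refl

BuiltFrom-⇄* : ∀ {P Q s r} → s ⇄* r → BuiltFrom P Q s ⇔ BuiltFrom P Q r
BuiltFrom-⇄* {P} {Q} = fold (λ s r → BuiltFrom P Q s ⇔ BuiltFrom P Q r)
                            (λ step → ⇔.trans (BuiltFrom-↝ (proj₁ step))) ⇔.refl

leaves : PT → List PT
leaves (fvar A n) = fvar A n ∷ []
leaves (bvar n)   = bvar n ∷ []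
leaves (lam _ r)  = leaves r
leaves (app r s)  = leaves r ++ leaves s
leaves (pair r s) = leaves r ++ leaves s
leaves (proj _ r) = leaves r

annotations : PT → List Ty
annotations (fvar A n) = []
annotations (bvar n)   = []
annotations (lam A r)  = A ∷ annotations r
annotations (app r s)  = annotations r ++ annotations s
annotations (pair r s) = annotations r ++ annotations s
annotations (proj A r) = A ∷ annotations r

BuiltFrom-++ˡ : ∀ {La Lt} Lb Lu s → BuiltFrom (_∈ La) (_∈ Lt) s →
                BuiltFrom (_∈ La ++ Lb) (_∈ Lt ++ Lu) s
BuiltFrom-++ˡ Lb Lu = BuiltFrom-mono (λ _ → ∈-++⁺ˡ) (λ _ → ∈-++⁺ˡ)

BuiltFrom-++ʳ : ∀ La Lt {Lb Lu} s → BuiltFrom (_∈ Lb) (_∈ Lu) s →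
                BuiltFrom (_∈ La ++ Lb) (_∈ Lt ++ Lu) s
BuiltFrom-++ʳ La Lt = BuiltFrom-mono (λ _ → ∈-++⁺ʳ La) (λ _ → ∈-++⁺ʳ Lt)

BuiltFrom-∷ : ∀ {La Lt} A s → BuiltFrom (_∈ La) (_∈ Lt) s → BuiltFrom (_∈ La) (_∈ A ∷ Lt) s
BuiltFrom-∷ A = BuiltFrom-mono (λ _ → id) (λ _ → there)

BuiltFrom-self : ∀ s → BuiltFrom (_∈ leaves s) (_∈ annotations s) s
BuiltFrom-self (fvar A n) = here refl
BuiltFrom-self (bvar n)   = here refl
BuiltFrom-self (lam A r)  = here refl , BuiltFrom-∷ A r (BuiltFrom-self r)
BuiltFrom-self (app r s)  = BuiltFrom-++ˡ (leaves s) (annotations s) r (BuiltFrom-self r)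
                          , BuiltFrom-++ʳ (leaves r) (annotations r) s (BuiltFrom-self s)
BuiltFrom-self (pair r s) = BuiltFrom-++ˡ (leaves s) (annotations s) r (BuiltFrom-self r)
                          , BuiltFrom-++ʳ (leaves r) (annotations r) s (BuiltFrom-self s)
BuiltFrom-self (proj A r) = here refl , BuiltFrom-∷ A r (BuiltFrom-self r)

layer : List PT → List Ty → List PT → List PT
layer La Lt T = La ++ cartesianProductWith lam Lt T ++ cartesianProductWith app T T
                   ++ cartesianProductWith pair T T ++ cartesianProductWith proj Lt T

module Layer (La : List PT) (Lt : List Ty) where

  leaf∈layer : ∀ {T x} → x ∈ La → x ∈ layer La Lt T
  leaf∈layer = ∈-++⁺ˡ

  lam∈layer : ∀ {T A r} → A ∈ Lt → r ∈ T → lam A r ∈ layer La Lt T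
  lam∈layer a b = ∈-++⁺ʳ La (∈-++⁺ˡ (∈-cartesianProductWith⁺ lam a b))

  app∈layer : ∀ {T r s} → r ∈ T → s ∈ T → app r s ∈ layer La Lt T
  app∈layer {T} a b = ∈-++⁺ʳ La (∈-++⁺ʳ (cartesianProductWith lam Lt T)
                    (∈-++⁺ˡ (∈-cartesianProductWith⁺ app a b)))

  pair∈layer : ∀ {T r s} → r ∈ T → s ∈ T → pair r s ∈ layer La Lt T
  pair∈layer {T} a b = ∈-++⁺ʳ La (∈-++⁺ʳ (cartesianProductWith lam Lt T)
                     (∈-++⁺ʳ (cartesianProductWith app T T)
                       (∈-++⁺ˡ (∈-cartesianProductWith⁺ pair a b))))

  proj∈layer : ∀ {T A r} → A ∈ Lt → r ∈ T → proj A r ∈ layer La Lt T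
  proj∈layer {T} a b = ∈-++⁺ʳ La (∈-++⁺ʳ (cartesianProductWith lam Lt T)
                     (∈-++⁺ʳ (cartesianProductWith app T T)
                       (∈-++⁺ʳ (cartesianProductWith pair T T)
                         (∈-cartesianProductWith⁺ proj a b))))

-- terms La Lt d lists all preterms of weight at most d built from La, Lt.
terms : List PT → List Ty → ℕ → List PT
terms La Lt zero    = []
terms La Lt (suc d) = layer La Lt (terms La Lt d)

-- Since weights are positive, each summand of a weight ≤ 1 + d is ≤ d.
left-≤ : ∀ {a b d} → 1 ≤ b → a + b ≤ suc d → a ≤ d
left-≤ {a} b>0 le = ≤-pred (≤-trans (m<m+n a b>0) le)

right-≤ : ∀ {a b d} → 1 ≤ a → a + b ≤ suc d → b ≤ d
right-≤ {b = b} a>0 le = ≤-pred (≤-trans (m<n+m b a>0) le)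

module _ {La : List PT} {Lt : List Ty} where
  open Layer La Lt

  terms-complete : ∀ d s → BuiltFrom (_∈ La) (_∈ Lt) s → weight s ≤ d →
                   s ∈ terms La Lt d
  terms-complete zero s _ le with ≤-trans (weight-positive s) le
  ... | ()
  terms-complete (suc d) (fvar A n) b _ = leaf∈layer {T = terms La Lt d} b
  terms-complete (suc d) (bvar n)   b _ = leaf∈layer {T = terms La Lt d} b
  terms-complete (suc d) (lam A r) (q , b) le =
    lam∈layer q (terms-complete d r b (left-≤ (weight-positive r) le))
  terms-complete (suc d) (app r s) (b , c) le =
    app∈layer (terms-complete d r b (left-≤ (weight-positive s) le))
              (terms-complete d s c (right-≤ (weight-positive r) le))
  terms-complete (suc d) (pair r s) (b , c) le =
    pair∈layer (terms-complete d r b (left-≤ (weight-positive s) le))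
               (terms-complete d s c (right-≤ (weight-positive r) le))
  terms-complete (suc d) (proj A r) (q , b) le =
    proj∈layer q (terms-complete d r b (left-≤ (s≤s z≤n) le))

bounded-finite : ∀ La Lt d → FiniteSet (λ s → BuiltFrom (_∈ La) (_∈ Lt) s × weight s ≤ d)
bounded-finite La Lt d = terms La Lt d , λ s (b , le) → terms-complete d s b le

mainTheorem17 : ∀ r → IsTerm r → FiniteSet (λ s → s ⇄* r)
mainTheorem17 r _ = L , λ s s⇄*r →
  complete s ( Equivalence.from (BuiltFrom-⇄* s⇄*r) (BuiltFrom-self r)
             , ≤-reflexive (weight-⇄* s⇄*r) )
  where
  open Σ (bounded-finite (leaves r) (annotations r) (weight r))
    renaming (proj₁ to L; proj₂ to complete)
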